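{- Let $P$ be a finite poset and let $x$ be the maximal element of a maximal chain of $P$ such that the bundle $\mathrm{bu}(x)$ is trivial. If $\partial x$ is connected, then $\mathcal{K}P$ is combinatorially equivalent to $\mathcal{K}(P- x)$, where $P-x$ is the induced subposet on $P\setminus\{x\}$.
   Context: For a finite poset $(P,\preceq)$: a lower set is $L\subseteq P$ with $y\preceq z\in L\Rightarrow y\in L$; $\partial z=\{y: y\prec z\}$; the bundle of $z$ is $\mathrm{bu}(z)=\{y:\partial y=\partial z\}$, trivial if $\mathrm{bu}(z)=\{z\}$; a subset is connected if it induces a connected subgraph of the Hasse diagram; a lower set $L$ is filled if for every $z\in P$ with $\partial z\subseteq L$ we have $L\cap\mathrm{bu}(z)\ne\emptyset$; a tube is a filled connected lower set; a tubing is a set of tubes, none equal to $P$, pairwise disjoint or nested, such that the union of the tubes of every nonempty subset is filled. The poset associahedron $\mathcal{K}P$ is a convex polytope whose poset of nonempty faces (ordered by inclusion) is isomorphic to the set of tubings of $P$ ordered by reverse containment, well-defined up to combinatorial equivalence (for the empty poset it is a point). -}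

module Defs where

open import Level using (0ℓ)
open import Data.Nat using (ℕ; zero; suc)
open import Data.Fin using (Fin; punchIn)
open import Data.Fin.Properties using (punchIn-injective)
open import Data.Fin.Subset using (Subset; _∈_; _⊆_; ⊤)
open import Data.Bool using (Bool; true)
open import Data.Product using (Σ; ∃; _×_; _,_; proj₁)
open import Data.Sum using (_⊎_)
open import Data.Empty using (⊥)
open import Relation.Nullary using (¬_)
open import Relation.Unary using (Pred)
open import Relation.Binary using (Decidable; IsPartialOrder)
open import Relation.Binary.PropositionalEquality
  using (_≡_; _≢_; refl; isEquivalence)
open import Function.Bundles using (_⇔_)

record FinPoset : Set₁ where
  field
    size           : ℕ
    _≼_            : Fin size → Fin size → Set
    isPartialOrder : IsPartialOrder _≡_ _≼_
    _≼?_           : Decidable _≼_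

module _ (P : FinPoset) where
  open FinPoset P

  _≺_ : Fin size → Fin size → Set
  y ≺ z = (y ≼ z) × (y ≢ z)

  _⋖_ : Fin size → Fin size → Set
  y ⋖ z = (y ≺ z) × (∀ w → ¬ ((y ≺ w) × (w ≺ z)))

  HasseAdj : Fin size → Fin size → Set
  HasseAdj a b = (a ⋖ b) ⊎ (b ⋖ a)

  ∂ : Fin size → Pred (Fin size) 0ℓ
  ∂ z = λ y → y ≺ z

  -- y ∈ bu(z)  iff  ∂ y = ∂ z
  InBundle : Fin size → Fin size → Set
  InBundle z y = ∀ w → (w ≺ y → w ≺ z) × (w ≺ z → w ≺ y)

  TrivialBundle : Fin size → Set
  TrivialBundle z = ∀ y → InBundle z y → y ≡ z

  data Walk (A : Pred (Fin size) 0ℓ) : Fin size → Fin size → Set where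
    here : ∀ {a} → A a → Walk A a a
    step : ∀ {a b c} → A a → HasseAdj a b → Walk A b c → Walk A a c

  Connected : Pred (Fin size) 0ℓ → Set
  Connected A = ∀ a b → A a → A b → Walk A a b

  LowerSet : Pred (Fin size) 0ℓ → Set
  LowerSet L = ∀ y z → y ≼ z → L z → L y

  Filled : Pred (Fin size) 0ℓ → Set
  Filled L = ∀ z → (∀ y → y ≺ z → L y) → ∃ λ y → L y × InBundle z y

  Tube : Subset size → Set
  Tube S = LowerSet (_∈ S) × Filled (_∈ S) × Connected (_∈ S)

  Collection : Set
  Collection = Subset size → Bool

  _∈C_ : Subset size → Collection → Set
  S ∈C 𝒯 = 𝒯 S ≡ true

  _⊆C_ : Collection → Collection → Set
  𝒮 ⊆C 𝒯 = ∀ S → S ∈C 𝒮 → S ∈C 𝒯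

  ⋃ : Collection → Pred (Fin size) 0ℓ
  ⋃ 𝒮 = λ x → ∃ λ S → (S ∈C 𝒮) × (x ∈ S)

  Disjoint : Subset size → Subset size → Set
  Disjoint S T = ∀ x → x ∈ S → x ∈ T → ⊥

  IsTubing : Collection → Set
  IsTubing 𝒯 =
      (∀ S → S ∈C 𝒯 → Tube S)
    × (∀ S → S ∈C 𝒯 → S ≢ ⊤)
    × (∀ S T → S ∈C 𝒯 → T ∈C 𝒯 → Disjoint S T ⊎ (S ⊆ T ⊎ T ⊆ S))
    × (∀ 𝒮 → 𝒮 ⊆C 𝒯 → (∃ λ S → S ∈C 𝒮) → Filled (⋃ 𝒮))

  Tubing : Set
  Tubing = Σ Collection IsTubing

  Chain : Subset size → Set
  Chain C = ∀ a b → a ∈ C → b ∈ C → (a ≼ b) ⊎ (b ≼ a)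

  MaximalChain : Subset size → Set
  MaximalChain C = Chain C × (∀ C′ → Chain C′ → C ⊆ C′ → C′ ⊆ C)

  IsMaximumOf : Subset size → Fin size → Set
  IsMaximumOf C x = (x ∈ C) × (∀ y → y ∈ C → y ≼ x)

private
  del : (n : ℕ) (R : Fin n → Fin n → Set) → IsPartialOrder _≡_ R →
        Decidable R → Fin n → FinPoset
  del (suc m) R po dec x = record
    { size = m
    ; _≼_ = λ a b → R (punchIn x a) (punchIn x b)
    ; isPartialOrder = record
        { isPreorder = record
            { isEquivalence = isEquivalence
            ; reflexive = λ { refl → IsPartialOrder.refl po }
            ; trans = IsPartialOrder.trans po
            }
        ; antisym = λ {a} {b} p q → punchIn-injective x a b (IsPartialOrder.antisym po p q)
        }
    ; _≼?_ = λ a b → dec (punchIn x a) (punchIn x b)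
    }

_-_ : (P : FinPoset) → Fin (FinPoset.size P) → FinPoset
P - x = del (FinPoset.size P) (FinPoset._≼_ P) (FinPoset.isPartialOrder P) (FinPoset._≼?_ P) x

-- Combinatorial equivalence of 𝒦P and 𝒦Q: by definition of 𝒦, the
-- poset of nonempty faces of 𝒦P is the poset of tubings of P ordered by
-- reverse containment; so 𝒦P ≃ 𝒦Q iff these posets are isomorphic.

record KEquiv (P Q : FinPoset) : Set where
  field
    to       : Tubing P → Tubing Q
    from     : Tubing Q → Tubing P
    from∘to  : ∀ t S → proj₁ (from (to t)) S ≡ proj₁ t S
    to∘from  : ∀ t S → proj₁ (to (from t)) S ≡ proj₁ t S
    order    : ∀ s t → (_⊆C_ P (proj₁ t) (proj₁ s)) ⇔ (_⊆C_ Q (proj₁ (to t)) (proj₁ (to s)))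

-- Since x is maximal with trivial bundle, a filled lower set contains x exactly when it contains ∂x.
-- Hence S ↦ S ∖ {x} is a bijection from the tubes of P onto those of P − x, inverted by adding x back
-- precisely when ∂x is present. Lower sets and fillings transfer because nothing lies above x; the
-- connectedness of ∂x is what makes the bijection respect connectivity (a walk through x is rerouted
-- inside ∂x) and unions (a laminar family covering ∂x has one member containing ∂x, hence x).
-- Applied member-wise, the bijection preserves tubings and their inclusions.

module Submission where

open import Defs
open import Data.Fin using (Fin)
open import Data.Product using (∃; _×_)

open import Data.Nat using (ℕ; zero; suc)
open import Data.Fin using (zero; punchIn; punchOut)
open import Data.Fin.Properties using (_≟_; punchIn-injective; punchIn-punchOut; punchInᵢ≢i; any?; all?)
open import Data.Fin.Subset using (Subset; _∈_; _⊆_; ⊤; _∪_; ⁅_⁆)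
open import Data.Fin.Subset.Properties using (_∈?_; ∈⊤; ⊆⊤; ⊆-antisym; x∈⁅x⁆; x∈⁅y⁆⇒x≡y; p⊆p∪q; x∈p∪q⁻; x∈p∪q⁺)
open import Data.Fin.Induction using (po-wellFounded; po-noetherian)
open import Data.Bool using (true)
open import Data.Bool.Properties using (⇔→≡) renaming (_≟_ to _≟ᵇ_)
open import Data.Vec using ([]; _∷_; insertAt; removeAt)
open import Data.Vec.Properties using (insertAt-lookup; insertAt-punchIn; removeAt-insertAt; insertAt-removeAt; []=⇒lookup; lookup⇒[]=; ≡-dec)
open import Data.List using ([]; _∷_; allFin)
open import Data.List.Relation.Unary.Any using (here; there)
open import Data.List.Membership.Propositional using () renaming (_∈_ to _∈ˡ_)
open import Data.List.Membership.Propositional.Properties using (∈-allFin)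
open import Data.Product using (_,_; proj₁; proj₂; swap)
open import Data.Sum using (_⊎_; inj₁; inj₂)
import Data.Sum as Sum
open import Data.Empty using (⊥-elim)
open import Function using (id; _∘_)
open import Function.Bundles using (_⇔_; mk⇔)
open import Relation.Nullary using (¬_; Dec; yes; no; does)
open import Relation.Nullary.Decidable using (_×-dec_; _→-dec_; ¬?; dec-true)
open import Relation.Unary using (Pred)
import Relation.Unary as U
open import Relation.Binary using (Decidable; IsPartialOrder)
open import Relation.Binary.PropositionalEquality using (_≡_; _≢_; refl; sym; trans; cong; subst)
open import Induction.WellFounded using (Acc; acc)
open import Level using (0ℓ)

does≡true⇒ : ∀ {A : Set} (a? : Dec A) → does a? ≡ true → A
does≡true⇒ (yes a) _ = a
does≡true⇒ (no _) ()

data PunchInView {n} (i : Fin (suc n)) : Fin (suc n) → Set where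
  pivot   : PunchInView i i
  punched : (a : Fin n) → PunchInView i (punchIn i a)

punchInView : ∀ {n} (i y : Fin (suc n)) → PunchInView i y
punchInView i y with i ≟ y
... | yes refl = pivot
... | no i≢y   = subst (PunchInView i) (punchIn-punchOut i≢y) (punched (punchOut i≢y))

module _ {n} {i : Fin (suc n)} where

  ∈-insertAt-pivot⁺ : ∀ {S : Subset n} {b} → b ≡ true → i ∈ insertAt S i b
  ∈-insertAt-pivot⁺ {S} {b} b≡true = lookup⇒[]= i _ (trans (insertAt-lookup S i b) b≡true)

  ∈-insertAt-pivot⁻ : ∀ {S : Subset n} {b} → i ∈ insertAt S i b → b ≡ true
  ∈-insertAt-pivot⁻ {S} {b} i∈ = trans (sym (insertAt-lookup S i b)) ([]=⇒lookup i∈)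

  ∈-insertAt-punchIn⁺ : ∀ {S : Subset n} {b a} → a ∈ S → punchIn i a ∈ insertAt S i b
  ∈-insertAt-punchIn⁺ {S} {b} {a} a∈ = lookup⇒[]= _ _ (trans (insertAt-punchIn S i b a) ([]=⇒lookup a∈))

  ∈-insertAt-punchIn⁻ : ∀ {S : Subset n} {b a} → punchIn i a ∈ insertAt S i b → a ∈ S
  ∈-insertAt-punchIn⁻ {S} {b} {a} a∈ = lookup⇒[]= _ _ (trans (sym (insertAt-punchIn S i b a)) ([]=⇒lookup a∈))

  ∈-removeAt⁺ : ∀ {S : Subset (suc n)} {a} → punchIn i a ∈ S → a ∈ removeAt S i
  ∈-removeAt⁺ {S} {a} a∈ =
    ∈-insertAt-punchIn⁻ (subst (punchIn i a ∈_) (sym (insertAt-removeAt S i)) a∈)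

  ∈-removeAt⁻ : ∀ {S : Subset (suc n)} {a} → a ∈ removeAt S i → punchIn i a ∈ S
  ∈-removeAt⁻ {S} a∈ = subst (_ ∈_) (insertAt-removeAt S i) (∈-insertAt-punchIn⁺ a∈)

≢⊤⇒Fin : ∀ {n} {S : Subset n} → S ≢ ⊤ → Fin n
≢⊤⇒Fin {S = []}    []≢⊤ = ⊥-elim ([]≢⊤ refl)
≢⊤⇒Fin {S = _ ∷ _} _    = zero

HasseAdj-sym : ∀ (P : FinPoset) {a b} → HasseAdj P a b → HasseAdj P b a
HasseAdj-sym P = Sum.swap

InBundle-sym : ∀ (P : FinPoset) {z y} → InBundle P z y → InBundle P y z
InBundle-sym P y∈bu w = swap (y∈bu w)

module _ {P : FinPoset} where

  Walk-head : ∀ {A u v} → Walk P A u v → A u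
  Walk-head (here Au)     = Au
  Walk-head (step Au _ _) = Au

  infixr 5 _++ʷ_
  _++ʷ_ : ∀ {A u v w} → Walk P A u v → Walk P A v w → Walk P A u w
  here _          ++ʷ q = q
  step Au u~b p   ++ʷ q = step Au u~b (p ++ʷ q)

  Walk-reverse : ∀ {A u v} → Walk P A u v → Walk P A v u
  Walk-reverse (here Au)       = here Au
  Walk-reverse (step Au u~b p) = Walk-reverse p ++ʷ step (Walk-head p) (HasseAdj-sym P u~b) (here Au)

  Walk-map : ∀ {A B : Pred (Fin (FinPoset.size P)) 0ℓ} {u v} → (∀ {y} → A y → B y) → Walk P A u v → Walk P B u v
  Walk-map f (here Au)       = here (f Au)
  Walk-map f (step Au u~b p) = step (f Au) u~b (Walk-map f p)

module _ (P : FinPoset) where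
  open FinPoset P
  open IsPartialOrder isPartialOrder using (antisym) renaming (refl to ≼-refl; trans to ≼-trans)

  private
    _<_ : Fin size → Fin size → Set
    _<_ = _≺_ P

  ≺-irrefl : ∀ {a} → ¬ a < a
  ≺-irrefl (_ , a≢a) = a≢a refl

  _≺?_ : Decidable _<_
  a ≺? b = (a ≼? b) ×-dec ¬? (a ≟ b)

  Connected-from-hub : ∀ {A h} → A h → (∀ u → A u → Walk P A h u) → Connected P A
  Connected-from-hub _ from-hub u v Au Av = Walk-reverse (from-hub u Au) ++ʷ from-hub v Av

  maximum-of-maximalChain-is-maximal : ∀ {C x} → MaximalChain P C → IsMaximumOf P C x → ∀ w → ¬ x < w
  maximum-of-maximalChain-is-maximal {C} {x} (C-chain , C-maximal) (x∈C , x-top) w (x≼w , x≢w) =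
    x≢w (antisym x≼w (x-top w (C-maximal C′ C′-chain (p⊆p∪q _) (x∈p∪q⁺ (inj₂ (x∈⁅x⁆ w))))))
    where
    C′ : Subset size
    C′ = C ∪ ⁅ w ⁆

    below-w : ∀ a → a ∈ C′ → a ≼ w
    below-w a a∈ with x∈p∪q⁻ C ⁅ w ⁆ a∈
    ... | inj₁ a∈C = ≼-trans (x-top a a∈C) x≼w
    ... | inj₂ a∈w rewrite x∈⁅y⁆⇒x≡y w a∈w = ≼-refl

    C′-chain : Chain P C′
    C′-chain a b a∈ b∈ with x∈p∪q⁻ C ⁅ w ⁆ a∈ | x∈p∪q⁻ C ⁅ w ⁆ b∈
    ... | inj₁ a∈C | inj₁ b∈C = C-chain a b a∈C b∈C
    ... | inj₂ a∈w | _         rewrite x∈⁅y⁆⇒x≡y w a∈w = inj₂ (below-w b b∈)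
    ... | inj₁ _   | inj₂ b∈w  rewrite x∈⁅y⁆⇒x≡y w b∈w = inj₁ (below-w a a∈)

  minimal-below : ∀ y → ∃ λ z → z ≼ y × (∀ w → ¬ w < z)
  minimal-below y = descend y (po-wellFounded isPartialOrder y)
    where
    descend : ∀ y → Acc _<_ y → ∃ λ z → z ≼ y × (∀ w → ¬ w < z)
    descend y (acc rs) with any? (_≺? y)
    ... | yes (w , w<y) = let z , z≼w , z-minimal = descend w (rs w<y) in z , ≼-trans z≼w (proj₁ w<y) , z-minimal
    ... | no nothing-below = y , ≼-refl , λ w w<y → nothing-below (w , w<y)

  -- A minimal element would share the empty ∂ of x, hence lie in its bundle.
  ∂-inhabited : ∀ {x y} → TrivialBundle P x → (∀ w → ¬ x < w) → y ≢ x → ∃ λ d → d < x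
  ∂-inhabited {x} {y} bu-trivial x-maximal y≢x with any? (_≺? x)
  ... | yes ∂x-inhabited = ∂x-inhabited
  ... | no ∂x-empty with minimal-below y
  ...   | z , z≼y , z-minimal
          with bu-trivial z (λ w → (λ w<z → ⊥-elim (z-minimal w w<z)) , λ w<x → ⊥-elim (∂x-empty (w , w<x)))
  ...     | refl = ⊥-elim (x-maximal y (z≼y , y≢x ∘ sym))

  cover-below : ∀ {d x} → d < x → ∃ λ c → _⋖_ P c x
  cover-below {d} {x} = ascend d (po-noetherian isPartialOrder d)
    where
    ascend : ∀ d → Acc (λ a b → b < a) d → d < x → ∃ λ c → _⋖_ P c x
    ascend d (acc rs) d<x with any? (λ w → (d ≺? w) ×-dec (w ≺? x))
    ... | yes (w , d<w , w<x) = ascend w (rs d<w) w<x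
    ... | no nothing-between = d , d<x , λ w between → nothing-between (w , between)

  filled-∂⊆⇒∈ : ∀ {L x} → Filled P L → TrivialBundle P x → (∀ y → y < x → L y) → L x
  filled-∂⊆⇒∈ L-filled bu-trivial ∂x⊆L with L-filled _ ∂x⊆L
  ... | y , Ly , y∈bu with bu-trivial y y∈bu
  ...   | refl = Ly

  NestedOrDisjoint : Subset size → Subset size → Set
  NestedOrDisjoint S T = Disjoint P S T ⊎ (S ⊆ T ⊎ T ⊆ S)

  Laminar : Collection P → Set
  Laminar 𝒮 = ∀ S T → _∈C_ P S 𝒮 → _∈C_ P T 𝒮 → NestedOrDisjoint S T

  module _ {𝒮 : Collection P} (laminar : Laminar 𝒮) where

    intersecting-members-nest : ∀ {S T y} → _∈C_ P S 𝒮 → _∈C_ P T 𝒮 → y ∈ S → y ∈ T →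
                                ∃ λ U → _∈C_ P U 𝒮 × S ⊆ U × T ⊆ U
    intersecting-members-nest {S} {T} S∈𝒮 T∈𝒮 y∈S y∈T with laminar S T S∈𝒮 T∈𝒮
    ... | inj₁ disjoint       = ⊥-elim (disjoint _ y∈S y∈T)
    ... | inj₂ (inj₁ S⊆T)     = T , T∈𝒮 , S⊆T , id
    ... | inj₂ (inj₂ T⊆S)     = S , S∈𝒮 , id , T⊆S

    module _ (lower : ∀ S → _∈C_ P S 𝒮 → LowerSet P (_∈ S)) where

      -- Hasse-adjacent elements of two members force them to intersect (at the lower element), hence to nest.
      walk-within-member : ∀ {u v} → Walk P (⋃ P 𝒮) u v → ∃ λ S → _∈C_ P S 𝒮 × u ∈ S × v ∈ S
      walk-within-member (here (S , S∈𝒮 , u∈S)) = S , S∈𝒮 , u∈S , u∈S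
      walk-within-member {u} (step {b = b} (S₀ , S₀∈𝒮 , u∈S₀) u~b rest) with walk-within-member rest
      ... | S , S∈𝒮 , b∈S , v∈S with common u~b
        where
        common : HasseAdj P u b → ∃ λ y → y ∈ S₀ × y ∈ S
        common (inj₁ ((u≼b , _) , _)) = u , u∈S₀ , lower S S∈𝒮 u b u≼b b∈S
        common (inj₂ ((b≼u , _) , _)) = b , lower S₀ S₀∈𝒮 b u b≼u u∈S₀ , b∈S
      ...   | y , y∈S₀ , y∈S with intersecting-members-nest S₀∈𝒮 S∈𝒮 y∈S₀ y∈S
      ...     | U , U∈𝒮 , S₀⊆U , S⊆U = U , U∈𝒮 , S₀⊆U u∈S₀ , S⊆U v∈S

      member-containing-connected : ∀ {A d} → U.Decidable A → Connected P A → A d →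
                                    (∀ {y} → A y → ⋃ P 𝒮 y) → ∃ λ S → _∈C_ P S 𝒮 × (∀ y → A y → y ∈ S)
      member-containing-connected {A} {d} A? A-connected Ad A⊆⋃ with absorb (allFin size)
        where
        absorb : ∀ l → ∃ λ S → _∈C_ P S 𝒮 × d ∈ S × (∀ e → e ∈ˡ l → A e → e ∈ S)
        absorb [] with A⊆⋃ Ad
        ... | S , S∈𝒮 , d∈S = S , S∈𝒮 , d∈S , λ _ ()
        absorb (e ∷ l) with absorb l | A? e
        ... | S , S∈𝒮 , d∈S , l⊆S | no ¬Ae = S , S∈𝒮 , d∈S , λ
          { _ (here refl) Ae  → ⊥-elim (¬Ae Ae)
          ; e′ (there e′∈l)   → l⊆S e′ e′∈l }
        ... | S , S∈𝒮 , d∈S , l⊆S | yes Ae with walk-within-member (Walk-map A⊆⋃ (A-connected d e Ad Ae))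
        ...   | T , T∈𝒮 , d∈T , e∈T with intersecting-members-nest S∈𝒮 T∈𝒮 d∈S d∈T
        ...     | U , U∈𝒮 , S⊆U , T⊆U = U , U∈𝒮 , S⊆U d∈S , λ
          { _ (here refl) _   → T⊆U e∈T
          ; e′ (there e′∈l)   → S⊆U ∘ l⊆S e′ e′∈l }
      ... | S , S∈𝒮 , _ , A⊆S = S , S∈𝒮 , λ y → A⊆S y (∈-allFin y)

  -- Connectedness of ∂x and laminarity put all of ∂x into a single member, which then contains x.
  ∂⊆⋃⇒∈⋃ : ∀ {x} {𝒮 : Collection P} → TrivialBundle P x → Connected P (∂ P x) → ∃ (∂ P x) →
           (∀ S → _∈C_ P S 𝒮 → Tube P S) → Laminar 𝒮 → (∀ y → y < x → ⋃ P 𝒮 y) → ⋃ P 𝒮 x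
  ∂⊆⋃⇒∈⋃ {x} bu-trivial ∂x-connected (d , d<x) tubes laminar ∂x⊆⋃
    with member-containing-connected laminar (λ S S∈𝒮 → proj₁ (tubes S S∈𝒮)) (_≺? x) ∂x-connected d<x (∂x⊆⋃ _)
  ... | S , S∈𝒮 , ∂x⊆S = S , S∈𝒮 , filled-∂⊆⇒∈ (proj₁ (proj₂ (tubes S S∈𝒮))) bu-trivial ∂x⊆S

module MaximalDeletion {m : ℕ} (_≼_ : Fin (suc m) → Fin (suc m) → Set) (≼-isPartialOrder : IsPartialOrder _≡_ _≼_)
                       (_≼?_ : Decidable _≼_) (x : Fin (suc m)) where

  P : FinPoset
  P = record { size = suc m ; _≼_ = _≼_ ; isPartialOrder = ≼-isPartialOrder ; _≼?_ = _≼?_ }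

  Q : FinPoset
  Q = P - x

  ι : Fin m → Fin (suc m)
  ι = punchIn x

  private
    _<_ : Fin (suc m) → Fin (suc m) → Set
    _<_ = _≺_ P

  ≺-punchIn⁺ : ∀ {a b} → _≺_ Q a b → ι a < ι b
  ≺-punchIn⁺ (a≼b , a≢b) = a≼b , a≢b ∘ punchIn-injective x _ _

  ≺-punchIn⁻ : ∀ {a b} → ι a < ι b → _≺_ Q a b
  ≺-punchIn⁻ (a≼b , a≢b) = a≼b , a≢b ∘ cong ι

  ⋖-punchIn⁻ : ∀ {a b} → _⋖_ P (ι a) (ι b) → _⋖_ Q a b
  ⋖-punchIn⁻ (a<b , nothing-between) =
    ≺-punchIn⁻ a<b , λ w (a<w , w<b) → nothing-between (ι w) (≺-punchIn⁺ a<w , ≺-punchIn⁺ w<b)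

  HasseAdj-punchIn⁻ : ∀ {a b} → HasseAdj P (ι a) (ι b) → HasseAdj Q a b
  HasseAdj-punchIn⁻ = Sum.map ⋖-punchIn⁻ ⋖-punchIn⁻

  InBundle-punchIn⁻ : ∀ {z y} → InBundle P (ι z) (ι y) → InBundle Q z y
  InBundle-punchIn⁻ y∈bu w =
    ≺-punchIn⁻ ∘ proj₁ (y∈bu (ι w)) ∘ ≺-punchIn⁺ , ≺-punchIn⁻ ∘ proj₂ (y∈bu (ι w)) ∘ ≺-punchIn⁺

  Walk-punchIn⁻ : ∀ {B a b} → Walk P (λ y → B y × y ≢ x) (ι a) (ι b) → Walk Q (B ∘ ι) a b
  Walk-punchIn⁻ w = unpunch w refl refl
    where
    unpunch : ∀ {B u v a b} → Walk P (λ y → B y × y ≢ x) u v → ι a ≡ u → ι b ≡ v → Walk Q (B ∘ ι) a b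
    unpunch (here (Bu , _)) refl ιb≡u with punchIn-injective x _ _ ιb≡u
    ... | refl = here Bu
    unpunch (step {b = c} (Bu , _) u~c rest) refl ιb≡v with punchInView x c
    ... | pivot      = ⊥-elim (proj₂ (Walk-head rest) refl)
    ... | punched c′ = step Bu (HasseAdj-punchIn⁻ u~c) (unpunch rest refl ιb≡v)

  restrict : Subset (suc m) → Subset m
  restrict S = removeAt S x

  ∂x⊆ : Subset m → Set
  ∂x⊆ S′ = ∀ a → ι a < x → a ∈ S′

  ∂x⊆? : U.Decidable ∂x⊆
  ∂x⊆? S′ = all? λ a → (_≺?_ P (ι a) x) →-dec (a ∈? S′)

  -- x is put in exactly when all of ∂x is present, as a filled lower set must then contain x.
  extend : Subset m → Subset (suc m)
  extend S′ = insertAt S′ x (does (∂x⊆? S′))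

  x∈extend⁺ : ∀ {S′} → ∂x⊆ S′ → x ∈ extend S′
  x∈extend⁺ {S′} ∂x⊆S′ = ∈-insertAt-pivot⁺ (dec-true (∂x⊆? S′) ∂x⊆S′)

  x∈extend⁻ : ∀ {S′} → x ∈ extend S′ → ∂x⊆ S′
  x∈extend⁻ {S′} x∈ = does≡true⇒ (∂x⊆? S′) (∈-insertAt-pivot⁻ x∈)

  restrict-extend : ∀ S′ → restrict (extend S′) ≡ S′
  restrict-extend S′ = removeAt-insertAt S′ x _

  extend-injective : ∀ {S′ T′} → extend S′ ≡ extend T′ → S′ ≡ T′
  extend-injective {S′} {T′} eq = trans (sym (restrict-extend S′)) (trans (cong restrict eq) (restrict-extend T′))

  extend-mono : ∀ {S′ T′} → S′ ⊆ T′ → extend S′ ⊆ extend T′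
  extend-mono {S′} {T′} S′⊆T′ {y} y∈ with punchInView x y
  ... | pivot     = x∈extend⁺ (λ a a<x → S′⊆T′ (x∈extend⁻ y∈ a a<x))
  ... | punched a = ∈-insertAt-punchIn⁺ (S′⊆T′ (∈-insertAt-punchIn⁻ y∈))

  extend-⊤ : extend ⊤ ≡ ⊤
  extend-⊤ = ⊆-antisym ⊆⊤ ⊤⊆extend-⊤
    where
    ⊤⊆extend-⊤ : ⊤ ⊆ extend ⊤
    ⊤⊆extend-⊤ {y} _ with punchInView x y
    ... | pivot     = x∈extend⁺ (λ _ _ → ∈⊤)
    ... | punched a = ∈-insertAt-punchIn⁺ ∈⊤

  restrictᶜ : Collection P → Collection Q
  restrictᶜ 𝒯 S′ = 𝒯 (extend S′)

  -- The image of 𝒯′ under extend, made decidable through the left inverse restrict of extend.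
  extendᶜ : Collection Q → Collection P
  extendᶜ 𝒯′ S = does ((≡-dec _≟ᵇ_ S (extend (restrict S))) ×-dec (𝒯′ (restrict S) ≟ᵇ true))

  ∈-extendᶜ⁺ : ∀ 𝒯′ {S′} → _∈C_ Q S′ 𝒯′ → _∈C_ P (extend S′) (extendᶜ 𝒯′)
  ∈-extendᶜ⁺ 𝒯′ {S′} S′∈𝒯′ = dec-true (≡-dec _≟ᵇ_ _ _ ×-dec (_ ≟ᵇ true))
    (cong extend (sym (restrict-extend S′)) , subst (λ T′ → _∈C_ Q T′ 𝒯′) (sym (restrict-extend S′)) S′∈𝒯′)

  ∈-extendᶜ⁻ : ∀ 𝒯′ S → _∈C_ P S (extendᶜ 𝒯′) → ∃ λ S′ → _∈C_ Q S′ 𝒯′ × extend S′ ≡ S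
  ∈-extendᶜ⁻ 𝒯′ S S∈ with does≡true⇒ (≡-dec _≟ᵇ_ _ _ ×-dec (_ ≟ᵇ true)) S∈
  ... | S≡ , S′∈𝒯′ = restrict S , S′∈𝒯′ , sym S≡

  ⋃-extendᶜ⁺ : ∀ {𝒮′ a} → ⋃ Q 𝒮′ a → ⋃ P (extendᶜ 𝒮′) (ι a)
  ⋃-extendᶜ⁺ {𝒮′} (S′ , S′∈𝒮′ , a∈S′) = extend S′ , ∈-extendᶜ⁺ 𝒮′ S′∈𝒮′ , ∈-insertAt-punchIn⁺ a∈S′

  ⋃-extendᶜ⁻ : ∀ {𝒮′ a} → ⋃ P (extendᶜ 𝒮′) (ι a) → ⋃ Q 𝒮′ a
  ⋃-extendᶜ⁻ {𝒮′} (S , S∈ , a∈S) with ∈-extendᶜ⁻ 𝒮′ S S∈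
  ... | S′ , S′∈𝒮′ , refl = S′ , S′∈𝒮′ , ∈-insertAt-punchIn⁻ a∈S

  NestedOrDisjoint-extend⁻ : ∀ {S′ T′} → NestedOrDisjoint P (extend S′) (extend T′) → NestedOrDisjoint Q S′ T′
  NestedOrDisjoint-extend⁻ (inj₁ disjoint)   =
    inj₁ λ a a∈S′ a∈T′ → disjoint (ι a) (∈-insertAt-punchIn⁺ a∈S′) (∈-insertAt-punchIn⁺ a∈T′)
  NestedOrDisjoint-extend⁻ (inj₂ (inj₁ S⊆T)) = inj₂ (inj₁ (∈-insertAt-punchIn⁻ ∘ S⊆T ∘ ∈-insertAt-punchIn⁺))
  NestedOrDisjoint-extend⁻ (inj₂ (inj₂ T⊆S)) = inj₂ (inj₂ (∈-insertAt-punchIn⁻ ∘ T⊆S ∘ ∈-insertAt-punchIn⁺))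

  module _ (x-maximal : ∀ w → ¬ x < w) where

    ⋖-punchIn⁺ : ∀ {a b} → _⋖_ Q a b → _⋖_ P (ι a) (ι b)
    ⋖-punchIn⁺ {a} {b} (a<b , nothing-between) = ≺-punchIn⁺ a<b , between-absurd
      where
      between-absurd : ∀ w → ¬ ((ι a < w) × (w < ι b))
      between-absurd w (a<w , w<b) with punchInView x w
      ... | pivot      = x-maximal (ι b) w<b
      ... | punched c  = nothing-between c (≺-punchIn⁻ a<w , ≺-punchIn⁻ w<b)

    HasseAdj-punchIn⁺ : ∀ {a b} → HasseAdj Q a b → HasseAdj P (ι a) (ι b)
    HasseAdj-punchIn⁺ = Sum.map ⋖-punchIn⁺ ⋖-punchIn⁺

    HasseAdj-x⇒≺x : ∀ {u} → HasseAdj P u x → u < x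
    HasseAdj-x⇒≺x (inj₁ (u<x , _)) = u<x
    HasseAdj-x⇒≺x (inj₂ (x<u , _)) = ⊥-elim (x-maximal _ x<u)

    InBundle-punchIn⁺ : ∀ {z y} → InBundle Q z y → InBundle P (ι z) (ι y)
    InBundle-punchIn⁺ {z} {y} y∈bu w with punchInView x w
    ... | pivot     = ⊥-elim ∘ x-maximal (ι y) , ⊥-elim ∘ x-maximal (ι z)
    ... | punched c = ≺-punchIn⁺ ∘ proj₁ (y∈bu c) ∘ ≺-punchIn⁻ , ≺-punchIn⁺ ∘ proj₂ (y∈bu c) ∘ ≺-punchIn⁻

    Walk-punchIn : ∀ {A B a b} → (∀ {c} → A c → B (ι c)) → Walk Q A a b → Walk P B (ι a) (ι b)
    Walk-punchIn f (here Aa)       = here (f Aa)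
    Walk-punchIn f (step Aa a~c p) = step (f Aa) (HasseAdj-punchIn⁺ a~c) (Walk-punchIn f p)

    LowerSet-extend : ∀ {S′} → LowerSet Q (_∈ S′) → LowerSet P (_∈ extend S′)
    LowerSet-extend {S′} S′-lower y z y≼z z∈ with punchInView x z | punchInView x y
    ... | pivot     | pivot     = z∈
    ... | pivot     | punched d = ∈-insertAt-punchIn⁺ (x∈extend⁻ z∈ d (y≼z , punchInᵢ≢i x d))
    ... | punched c | pivot     = ⊥-elim (x-maximal (ι c) (y≼z , punchInᵢ≢i x c ∘ sym))
    ... | punched c | punched d = ∈-insertAt-punchIn⁺ (S′-lower d c y≼z (∈-insertAt-punchIn⁻ z∈))

    module _ (bu-trivial : TrivialBundle P x) (∂x-connected : Connected P (∂ P x)) where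

      -- A walk through x enters and leaves it from below; replace that visit by a walk inside ∂x.
      avoid-x : ∀ {A u v} → LowerSet P A → Walk P A u v → u ≢ x → v ≢ x → Walk P (λ y → A y × y ≢ x) u v
      avoid-x A-lower (here Au) u≢x _ = here (Au , u≢x)
      avoid-x A-lower (step {b = b} Au u~b rest) u≢x v≢x with b ≟ x
      ... | no b≢x = step (Au , u≢x) u~b (avoid-x A-lower rest b≢x v≢x)
      avoid-x A-lower (step Au u~x (here _)) u≢x v≢x | yes refl = ⊥-elim (v≢x refl)
      avoid-x {A} A-lower (step {a = u} Au u~x (step {b = c} Ax x~c rest)) u≢x v≢x | yes refl =
        Walk-map inside (∂x-connected u c u<x c<x) ++ʷ avoid-x A-lower rest (proj₂ c<x) v≢x
        where
        u<x : u < x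
        u<x = HasseAdj-x⇒≺x u~x
        c<x : c < x
        c<x = HasseAdj-x⇒≺x (HasseAdj-sym P x~c)
        inside : ∀ {y} → y < x → A y × y ≢ x
        inside (y≼x , y≢x) = A-lower _ x y≼x Ax , y≢x

      filled-restrict : ∀ {B A} → (∀ {a} → A a → B (ι a)) → (∀ {a} → B (ι a) → A a) → Filled P B → Filled Q A
      filled-restrict {B} {A} A⊆B B⊆A B-filled z ∂z⊆A with B-filled (ι z) ∂ιz⊆B
        where
        ∂ιz⊆B : ∀ y → y < ι z → B y
        ∂ιz⊆B y y<z with punchInView x y
        ... | pivot     = ⊥-elim (x-maximal (ι z) y<z)
        ... | punched a = A⊆B (∂z⊆A a (≺-punchIn⁻ y<z))
      ... | y , By , y∈bu with punchInView x y
      ...   | pivot     = ⊥-elim (punchInᵢ≢i x z (bu-trivial (ι z) (InBundle-sym P y∈bu)))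
      ...   | punched a = a , B⊆A By , InBundle-punchIn⁻ y∈bu

      filled-extend : ∀ {B A} → (∀ {a} → A a → B (ι a)) → (∀ {a} → B (ι a) → A a) →
                      ((∀ y → y < x → B y) → B x) → Filled Q A → Filled P B
      filled-extend A⊆B B⊆A x-filled A-filled z ∂z⊆B with punchInView x z
      ... | pivot     = x , x-filled ∂z⊆B , λ _ → id , id
      ... | punched c with A-filled c (λ d d<c → B⊆A (∂z⊆B (ι d) (≺-punchIn⁺ d<c)))
      ...   | d , Ad , d∈bu = ι d , A⊆B Ad , InBundle-punchIn⁺ d∈bu

      punchIn-cover-of-x : Fin m → ∃ λ c → _⋖_ P (ι c) x
      punchIn-cover-of-x a with cover-below P (proj₂ (∂-inhabited P bu-trivial x-maximal (punchInᵢ≢i x a)))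
      ... | c , c⋖x with punchInView x c
      ...   | pivot      = ⊥-elim (≺-irrefl P (proj₁ c⋖x))
      ...   | punched c′ = c′ , c⋖x

      extend-restrict : ∀ {S} → Tube P S → extend (restrict S) ≡ S
      extend-restrict {S} (S-lower , S-filled , _) = ⊆-antisym extend-restrict⊆ ⊆extend-restrict
        where
        extend-restrict⊆ : extend (restrict S) ⊆ S
        extend-restrict⊆ {y} y∈ with punchInView x y
        ... | pivot     = filled-∂⊆⇒∈ P S-filled bu-trivial ∂x⊆S
          where
          ∂x⊆S : ∀ y → y < x → y ∈ S
          ∂x⊆S y y<x with punchInView x y
          ... | pivot     = ⊥-elim (≺-irrefl P y<x)
          ... | punched a = ∈-removeAt⁻ (x∈extend⁻ y∈ a y<x)
        ... | punched a = ∈-removeAt⁻ (∈-insertAt-punchIn⁻ y∈)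

        ⊆extend-restrict : S ⊆ extend (restrict S)
        ⊆extend-restrict {y} y∈ with punchInView x y
        ... | pivot     = x∈extend⁺ (λ a (a≼x , _) → ∈-removeAt⁺ (S-lower (ι a) x a≼x y∈))
        ... | punched a = ∈-insertAt-punchIn⁺ (∈-removeAt⁺ y∈)

      Connected-restrict : ∀ {S} → LowerSet P (_∈ S) → Connected P (_∈ S) → Connected Q (_∈ restrict S)
      Connected-restrict S-lower S-connected a b a∈ b∈ =
        Walk-map ∈-removeAt⁺
          (Walk-punchIn⁻ (avoid-x S-lower (S-connected (ι a) (ι b) (∈-removeAt⁻ a∈) (∈-removeAt⁻ b∈))
                                  (punchInᵢ≢i x a) (punchInᵢ≢i x b)))

      Connected-extend : ∀ {S′} → Connected Q (_∈ S′) → Connected P (_∈ extend S′)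
      Connected-extend {S′} S′-connected with x ∈? extend S′
      ... | yes x∈ = Connected-from-hub P x∈ from-x
        where
        from-x : ∀ u → u ∈ extend S′ → Walk P (_∈ extend S′) x u
        from-x u u∈ with punchInView x u
        ... | pivot     = here x∈
        ... | punched a with punchIn-cover-of-x a
        ...   | c , c⋖x = step x∈ (inj₂ c⋖x)
                            (Walk-punchIn ∈-insertAt-punchIn⁺
                               (S′-connected c a (x∈extend⁻ x∈ c (proj₁ c⋖x)) (∈-insertAt-punchIn⁻ u∈)))
      ... | no x∉ = λ u v u∈ v∈ → walk u v u∈ v∈
        where
        walk : ∀ u v → u ∈ extend S′ → v ∈ extend S′ → Walk P (_∈ extend S′) u v
        walk u v u∈ v∈ with punchInView x u | punchInView x v
        ... | pivot     | _         = ⊥-elim (x∉ u∈)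
        ... | punched _ | pivot     = ⊥-elim (x∉ v∈)
        ... | punched a | punched b =
          Walk-punchIn ∈-insertAt-punchIn⁺ (S′-connected a b (∈-insertAt-punchIn⁻ u∈) (∈-insertAt-punchIn⁻ v∈))

      Tube-restrict : ∀ {S} → Tube P S → Tube Q (restrict S)
      Tube-restrict (S-lower , S-filled , S-connected) =
          (λ a b a≼b b∈ → ∈-removeAt⁺ (S-lower (ι a) (ι b) a≼b (∈-removeAt⁻ b∈)))
        , filled-restrict ∈-removeAt⁻ ∈-removeAt⁺ S-filled
        , Connected-restrict S-lower S-connected

      Tube-extend : ∀ {S′} → Tube Q S′ → Tube P (extend S′)
      Tube-extend (S′-lower , S′-filled , S′-connected) =
          LowerSet-extend S′-lower
        , filled-extend ∈-insertAt-punchIn⁺ ∈-insertAt-punchIn⁻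
            (λ ∂x⊆S → x∈extend⁺ λ a a<x → ∈-insertAt-punchIn⁻ (∂x⊆S (ι a) a<x)) S′-filled
        , Connected-extend S′-connected

      IsTubing-restrict : ∀ {𝒯} → IsTubing P 𝒯 → IsTubing Q (restrictᶜ 𝒯)
      IsTubing-restrict {𝒯} (tubes , proper , laminar , unions-filled) =
          (λ S′ S′∈ → subst (Tube Q) (restrict-extend S′) (Tube-restrict (tubes _ S′∈)))
        , (λ S′ S′∈ S′≡⊤ → proper _ S′∈ (trans (cong extend S′≡⊤) extend-⊤))
        , (λ S′ T′ S′∈ T′∈ → NestedOrDisjoint-extend⁻ (laminar _ _ S′∈ T′∈))
        , λ 𝒮′ 𝒮′⊆ (S′ , S′∈𝒮′) →
            filled-restrict ⋃-extendᶜ⁺ ⋃-extendᶜ⁻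
              (unions-filled (extendᶜ 𝒮′) (extend-⊆C 𝒮′⊆) (extend S′ , ∈-extendᶜ⁺ 𝒮′ S′∈𝒮′))
        where
        extend-⊆C : ∀ {𝒮′} → _⊆C_ Q 𝒮′ (restrictᶜ 𝒯) → _⊆C_ P (extendᶜ 𝒮′) 𝒯
        extend-⊆C {𝒮′} 𝒮′⊆ S S∈ with ∈-extendᶜ⁻ 𝒮′ S S∈
        ... | S′ , S′∈𝒮′ , refl = 𝒮′⊆ S′ S′∈𝒮′

      -- Two extensions can only meet at x if both contain ∂x, which is inhabited as soon as Q is.
      NestedOrDisjoint-extend⁺ : ∀ {S′ T′} → Fin m → NestedOrDisjoint Q S′ T′ →
                                 NestedOrDisjoint P (extend S′) (extend T′)
      NestedOrDisjoint-extend⁺ a (inj₁ disjoint) = inj₁ disjoint′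
        where
        disjoint′ : Disjoint P (extend _) (extend _)
        disjoint′ y y∈S y∈T with punchInView x y
        ... | punched b = disjoint b (∈-insertAt-punchIn⁻ y∈S) (∈-insertAt-punchIn⁻ y∈T)
        ... | pivot with punchIn-cover-of-x a
        ...   | c , c⋖x = disjoint c (x∈extend⁻ y∈S c (proj₁ c⋖x)) (x∈extend⁻ y∈T c (proj₁ c⋖x))
      NestedOrDisjoint-extend⁺ _ (inj₂ (inj₁ S′⊆T′)) = inj₂ (inj₁ (extend-mono S′⊆T′))
      NestedOrDisjoint-extend⁺ _ (inj₂ (inj₂ T′⊆S′)) = inj₂ (inj₂ (extend-mono T′⊆S′))

      IsTubing-extend : ∀ {𝒯′} → IsTubing Q 𝒯′ → IsTubing P (extendᶜ 𝒯′)
      IsTubing-extend {𝒯′} (tubes′ , proper′ , laminar′ , unions-filled′) = tubes , proper , laminar , unions-filled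
        where
        tubes : ∀ S → _∈C_ P S (extendᶜ 𝒯′) → Tube P S
        tubes S S∈ with ∈-extendᶜ⁻ 𝒯′ S S∈
        ... | S′ , S′∈𝒯′ , refl = Tube-extend (tubes′ S′ S′∈𝒯′)

        proper : ∀ S → _∈C_ P S (extendᶜ 𝒯′) → S ≢ ⊤
        proper S S∈ with ∈-extendᶜ⁻ 𝒯′ S S∈
        ... | S′ , S′∈𝒯′ , refl = proper′ S′ S′∈𝒯′ ∘ extend-injective ∘ λ S≡⊤ → trans S≡⊤ (sym extend-⊤)

        laminar : Laminar P (extendᶜ 𝒯′)
        laminar S T S∈ T∈ with ∈-extendᶜ⁻ 𝒯′ S S∈ | ∈-extendᶜ⁻ 𝒯′ T T∈
        ... | S′ , S′∈𝒯′ , refl | T′ , T′∈𝒯′ , refl =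
          NestedOrDisjoint-extend⁺ (≢⊤⇒Fin (proper′ S′ S′∈𝒯′)) (laminar′ S′ T′ S′∈𝒯′ T′∈𝒯′)

        unions-filled : ∀ 𝒮 → _⊆C_ P 𝒮 (extendᶜ 𝒯′) → (∃ λ S → _∈C_ P S 𝒮) → Filled P (⋃ P 𝒮)
        unions-filled 𝒮 𝒮⊆ (S₀ , S₀∈𝒮) with ∈-extendᶜ⁻ 𝒯′ S₀ (𝒮⊆ S₀ S₀∈𝒮)
        ... | S₀′ , S₀′∈𝒯′ , refl =
          filled-extend ⋃⁺ ⋃⁻ x∈⋃ (unions-filled′ (restrictᶜ 𝒮) restrict-⊆C (S₀′ , S₀∈𝒮))
          where
          restrict-⊆C : _⊆C_ Q (restrictᶜ 𝒮) 𝒯′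
          restrict-⊆C S′ S′∈ with ∈-extendᶜ⁻ 𝒯′ _ (𝒮⊆ _ S′∈)
          ... | T′ , T′∈𝒯′ , eq = subst (λ U → _∈C_ Q U 𝒯′) (extend-injective eq) T′∈𝒯′

          ⋃⁺ : ∀ {a} → ⋃ Q (restrictᶜ 𝒮) a → ⋃ P 𝒮 (ι a)
          ⋃⁺ (S′ , S′∈ , a∈S′) = extend S′ , S′∈ , ∈-insertAt-punchIn⁺ a∈S′

          ⋃⁻ : ∀ {a} → ⋃ P 𝒮 (ι a) → ⋃ Q (restrictᶜ 𝒮) a
          ⋃⁻ (S , S∈ , a∈S) with ∈-extendᶜ⁻ 𝒯′ S (𝒮⊆ S S∈)
          ... | S′ , _ , refl = S′ , S∈ , ∈-insertAt-punchIn⁻ a∈S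

          x∈⋃ : (∀ y → y < x → ⋃ P 𝒮 y) → ⋃ P 𝒮 x
          x∈⋃ = ∂⊆⋃⇒∈⋃ P bu-trivial ∂x-connected
                  (∂-inhabited P bu-trivial x-maximal (punchInᵢ≢i x (≢⊤⇒Fin (proper′ S₀′ S₀′∈𝒯′))))
                  (λ S S∈ → tubes S (𝒮⊆ S S∈)) (λ S T S∈ T∈ → laminar S T (𝒮⊆ S S∈) (𝒮⊆ T T∈))

      restrict-∈restrictᶜ : ∀ {𝒯} → IsTubing P 𝒯 → ∀ S → _∈C_ P S 𝒯 → _∈C_ Q (restrict S) (restrictᶜ 𝒯)
      restrict-∈restrictᶜ {𝒯} (tubes , _) S S∈𝒯 = subst (λ U → _∈C_ P U 𝒯) (sym (extend-restrict (tubes S S∈𝒯))) S∈𝒯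

      extendᶜ-restrictᶜ : ∀ {𝒯} → IsTubing P 𝒯 → ∀ S → extendᶜ (restrictᶜ 𝒯) S ≡ 𝒯 S
      extendᶜ-restrictᶜ {𝒯} 𝒯-tubing@(tubes , _) S = ⇔→≡ (mk⇔ ⊆𝒯 𝒯⊆)
        where
        ⊆𝒯 : _∈C_ P S (extendᶜ (restrictᶜ 𝒯)) → _∈C_ P S 𝒯
        ⊆𝒯 S∈ with ∈-extendᶜ⁻ (restrictᶜ 𝒯) S S∈
        ... | _ , S′∈ , refl = S′∈

        𝒯⊆ : _∈C_ P S 𝒯 → _∈C_ P S (extendᶜ (restrictᶜ 𝒯))
        𝒯⊆ S∈𝒯 = subst (λ U → _∈C_ P U (extendᶜ (restrictᶜ 𝒯))) (extend-restrict (tubes S S∈𝒯))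
                   (∈-extendᶜ⁺ (restrictᶜ 𝒯) (restrict-∈restrictᶜ 𝒯-tubing S S∈𝒯))

      restrictᶜ-extendᶜ : ∀ 𝒯′ S′ → restrictᶜ (extendᶜ 𝒯′) S′ ≡ 𝒯′ S′
      restrictᶜ-extendᶜ 𝒯′ S′ = ⇔→≡ (mk⇔ ⊆𝒯′ (∈-extendᶜ⁺ 𝒯′))
        where
        ⊆𝒯′ : _∈C_ P (extend S′) (extendᶜ 𝒯′) → _∈C_ Q S′ 𝒯′
        ⊆𝒯′ S∈ with ∈-extendᶜ⁻ 𝒯′ _ S∈
        ... | T′ , T′∈𝒯′ , eq = subst (λ U → _∈C_ Q U 𝒯′) (extend-injective eq) T′∈𝒯′

      ⊆C-restrictᶜ : ∀ {𝒯} 𝒮 → IsTubing P 𝒯 → _⊆C_ P 𝒯 𝒮 ⇔ _⊆C_ Q (restrictᶜ 𝒯) (restrictᶜ 𝒮)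
      ⊆C-restrictᶜ {𝒯} 𝒮 𝒯-tubing@(tubes , _) = mk⇔ (λ 𝒯⊆𝒮 S′ → 𝒯⊆𝒮 (extend S′)) from′
        where
        from′ : _⊆C_ Q (restrictᶜ 𝒯) (restrictᶜ 𝒮) → _⊆C_ P 𝒯 𝒮
        from′ 𝒯′⊆𝒮′ S S∈𝒯 = subst (λ U → _∈C_ P U 𝒮) (extend-restrict (tubes S S∈𝒯))
                              (𝒯′⊆𝒮′ (restrict S) (restrict-∈restrictᶜ 𝒯-tubing S S∈𝒯))

      KEquiv-deletion : KEquiv P Q
      KEquiv-deletion = record
        { to      = λ (𝒯 , 𝒯-tubing) → restrictᶜ 𝒯 , IsTubing-restrict 𝒯-tubing
        ; from    = λ (𝒯′ , 𝒯′-tubing) → extendᶜ 𝒯′ , IsTubing-extend 𝒯′-tubing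
        ; from∘to = λ (_ , 𝒯-tubing) → extendᶜ-restrictᶜ 𝒯-tubing
        ; to∘from = λ (𝒯′ , _) → restrictᶜ-extendᶜ 𝒯′
        ; order   = λ (𝒮 , _) (_ , 𝒯-tubing) → ⊆C-restrictᶜ 𝒮 𝒯-tubing
        }

corollary3p4 : (P : FinPoset) (x : Fin (FinPoset.size P)) →
    (∃ λ C → MaximalChain P C × IsMaximumOf P C x) →
    TrivialBundle P x →
    Connected P (∂ P x) →
    KEquiv P (P - x)
corollary3p4 record { size = zero } ()
corollary3p4 record { size = suc _ ; _≼_ = _≼_ ; isPartialOrder = ≼-isPartialOrder ; _≼?_ = _≼?_ } x
             (C , C-maximalChain , x-maximum) bu-trivial ∂x-connected =
  KEquiv-deletion (maximum-of-maximalChain-is-maximal P C-maximalChain x-maximum) bu-trivial ∂x-connected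
  where open MaximalDeletion _≼_ ≼-isPartialOrder _≼?_ x using (P; KEquiv-deletion)
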